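{- Let $k$ be a positive even integer. There are infinitely many primes $p$ such that $p+k$ is also prime if and only if the equation \[\sigma_2(n)-n^2=2n+(k^2+1)\] has infinitely many positive integer solutions $n$.
   Context: $\sigma_2(n)=\sum_{d\mid n}d^2$. -}

module Defs where

open import Data.Nat using (ℕ; zero; suc; _+_; _*_; _^_; _≤_)
open import Data.Nat.Divisibility using (_∣?_)
open import Data.List using (List; map; filter)
open import Data.Nat.ListAction using (sum)
open import Data.List.Base using (upTo)
open import Data.Product using (∃-syntax; _×_)

-- divisors of n : the list of d ∈ {1,…,n} with d ∣ n  (empty for n = 0)
divisors : ℕ → List ℕ
divisors n = filter (_∣? n) (map suc (upTo n))

σ₂ : ℕ → ℕ
σ₂ n = sum (map (λ d → d ^ 2) (divisors n))

Infinite : (ℕ → Set) → Set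
Infinite P = ∀ N → ∃[ m ] (N ≤ m × P m)

module Submission where

-- σ₂(n) − n² is the sum of d² over the proper divisors d of n.  We work with the
-- restricted sums σ₂∖ n S = ∑ { d² | d ∣ n, d ∉ S } and split off known divisors
-- one at a time (σ₂∖-peel).  For primes p < q the proper divisors of pq are 1, p, q,
-- and 1 + p² + q² = 2pq + (q − p)² + 1, so each prime pair (p, p + k) yields the
-- solution n = p (p + k).  Conversely let n > (N + k)³ be a solution.  It is not
-- prime, so n = a b with 2 ≤ a ≤ b.  When the excluded set S is closed under
-- d ↦ n / d, the remaining sum is 0 or at least n (at least 2n if also √n ∈ S).
-- This rules out a = b, and for a < b it forces b = a + k with 1, a, b the only
-- proper divisors of n; hence a is prime, and b is prime unless b = a², which the
-- size of n excludes, as it excludes a < N.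

open import Defs
open import Data.Nat using (ℕ; zero; suc; _+_; _*_; _∸_; _^_; _≤_; _<_; z≤n; s≤s; z<s; s<s;
  NonZero; >-nonZero; >-nonZero⁻¹; ≢-nonZero⁻¹; nonTrivial⇒n>1; n>1⇒nonTrivial)
open import Data.Nat.Properties
open import Data.Nat.Divisibility using (_∣_; divides; ∣-trans; _∣?_; ∣⇒≤; 0∣⇒≡0; ∣-refl; 1∣_)
open import Data.Nat.Primality using (Prime; Composite; composite; euclidsLemma; prime⇒irreducible;
  irreducible⇒prime; prime⇒nonZero; prime⇒nonTrivial; ¬prime⇒composite)
open import Data.Nat.ListAction using (sum)
open import Data.List using (List; []; _∷_; map; filter; applyUpTo; upTo)
open import Data.List.Properties using (map-∘)
open import Data.List.Membership.Propositional using (_∈_; _∉_)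
open import Data.List.Membership.DecPropositional _≟_ using (_∈?_)
open import Data.List.Relation.Unary.Any using (here; there)
open import Data.Bool using (true; false; if_then_else_)
open import Data.Product using (∃-syntax; _×_; _,_)
open import Data.Sum using (_⊎_; inj₁; inj₂; [_,_]′)
open import Relation.Nullary using (Dec; yes; no; does; ¬_; contradiction; _×-dec_; ¬?)
open import Relation.Unary using (Decidable)
open import Relation.Binary.PropositionalEquality
open import Relation.Binary.Definitions using (tri<; tri≈; tri>)
open import Function using (_∘_)
open import Function.Bundles using (_⇔_; mk⇔)
open import Data.Nat.Tactic.RingSolver using (solve-∀)
open import Algebra.Properties.CommutativeSemigroup +-commutativeSemigroup using (x∙yz≈y∙xz)

Σ< : ℕ → (ℕ → ℕ) → ℕ
Σ< zero    f = 0
Σ< (suc n) f = f 0 + Σ< n (f ∘ suc)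

Σ<-cong : ∀ n {f g : ℕ → ℕ} → (∀ d → f d ≡ g d) → Σ< n f ≡ Σ< n g
Σ<-cong zero    f≗g = refl
Σ<-cong (suc n) f≗g = cong₂ _+_ (f≗g 0) (Σ<-cong n (f≗g ∘ suc))

Σ<-extract : ∀ n {a} {f g : ℕ → ℕ} → a < n → g a ≡ 0 → (∀ {d} → d ≢ a → f d ≡ g d) →
             Σ< n f ≡ f a + Σ< n g
Σ<-extract (suc n) {zero} {f} {g} _ g0≡0 agree =
  cong (f 0 +_) (trans (Σ<-cong n (λ d → agree λ ())) (cong (_+ Σ< n (g ∘ suc)) (sym g0≡0)))
Σ<-extract (suc n) {suc a} {f} {g} (s<s a<n) ga≡0 agree = begin
  f 0 + Σ< n (f ∘ suc)                  ≡⟨ cong (f 0 +_) (Σ<-extract n a<n ga≡0 shifted) ⟩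
  f 0 + (f (suc a) + Σ< n (g ∘ suc))    ≡⟨ x∙yz≈y∙xz (f 0) (f (suc a)) _ ⟩
  f (suc a) + (f 0 + Σ< n (g ∘ suc))    ≡⟨ cong (λ x → f (suc a) + (x + Σ< n (g ∘ suc))) (agree λ ()) ⟩
  f (suc a) + (g 0 + Σ< n (g ∘ suc))    ∎
  where
  open ≡-Reasoning
  shifted : ∀ {d} → d ≢ a → f (suc d) ≡ g (suc d)
  shifted d≢a = agree (d≢a ∘ suc-injective)

Σ<-witness : ∀ n (f : ℕ → ℕ) → 0 < Σ< n f → ∃[ d ] (d < n × 0 < f d)
Σ<-witness (suc n) f pos with f 0 in f0
... | suc _ = 0 , z<s , subst (0 <_) (sym f0) z<s
... | zero with Σ<-witness n (f ∘ suc) pos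
...   | d , d<n , pos-d = suc d , s<s d<n , pos-d

sum-map-applyUpTo : ∀ (f g : ℕ → ℕ) n → sum (map f (applyUpTo g n)) ≡ Σ< n (f ∘ g)
sum-map-applyUpTo f g zero    = refl
sum-map-applyUpTo f g (suc n) = cong (f (g 0) +_) (sum-map-applyUpTo f (g ∘ suc) n)

opaque
  indicator : ∀ {p} {P : Set p} → Dec P → ℕ → ℕ
  indicator P? x = if does P? then x else 0

  indicator-yes : ∀ {p} {P : Set p} {P? : Dec P} {x} → P → indicator P? x ≡ x
  indicator-yes {P? = yes _}  _  = refl
  indicator-yes {P? = no ¬Px} Px = contradiction Px ¬Px

  indicator-no : ∀ {p} {P : Set p} {P? : Dec P} {x} → ¬ P → indicator P? x ≡ 0
  indicator-no {P? = yes Px} ¬Px = contradiction Px ¬Px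
  indicator-no {P? = no _}   _   = refl

  indicator-pos : ∀ {p} {P : Set p} {P? : Dec P} {x} → 0 < indicator P? x → P
  indicator-pos {P? = yes Px} _ = Px

  indicator-cong : ∀ {p q} {P : Set p} {Q : Set q} {P? : Dec P} {Q? : Dec Q} {x y} →
                   (P → Q) → (Q → P) → x ≡ y → indicator P? x ≡ indicator Q? y
  indicator-cong {P? = yes _}  {Q? = yes _}  _   _   x≡y = x≡y
  indicator-cong {P? = no _}   {Q? = no _}   _   _   _   = refl
  indicator-cong {P? = yes Px} {Q? = no ¬Qx} P⇒Q _   _   = contradiction (P⇒Q Px) ¬Qx
  indicator-cong {P? = no ¬Px} {Q? = yes Qx} _   Q⇒P _   = contradiction (Q⇒P Qx) ¬Px

  indicator-zero : ∀ {p} {P : Set p} (P? : Dec P) → indicator P? 0 ≡ 0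
  indicator-zero (yes _) = refl
  indicator-zero (no _)  = refl

  sum-map-filter : ∀ {p} {P : ℕ → Set p} (P? : Decidable P) (f : ℕ → ℕ) xs →
                   sum (map f (filter P? xs)) ≡ sum (map (λ x → indicator (P? x) (f x)) xs)
  sum-map-filter P? f []       = refl
  sum-map-filter P? f (x ∷ xs) with does (P? x)
  ... | true  = cong (f x +_) (sum-map-filter P? f xs)
  ... | false = sum-map-filter P? f xs

Counted : ℕ → List ℕ → ℕ → Set
Counted n S d = d ∣ n × d ∉ S

counted? : ∀ n S d → Dec (Counted n S d)
counted? n S d = d ∣? n ×-dec ¬? (d ∈? S)

contribution : ℕ → List ℕ → ℕ → ℕ
contribution n S d = indicator (counted? n S d) (d * d)

σ₂∖ : ℕ → List ℕ → ℕ
σ₂∖ n S = Σ< (suc n) (contribution n S)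

∉-∷ : ∀ {x y : ℕ} {S} → x ≢ y → x ∉ S → x ∉ y ∷ S
∉-∷ x≢y x∉S (here x≡y)  = x≢y x≡y
∉-∷ x≢y x∉S (there x∈S) = x∉S x∈S

-- The ring solver works with products, so squares are written x * x.
square : ∀ x → x ^ 2 ≡ x * x
square x = cong (x *_) (*-identityʳ x)

-- With nothing excluded we recover σ₂ (the extra d = 0 term is 0).
σ₂≡σ₂∖[] : ∀ n → σ₂ n ≡ σ₂∖ n []
σ₂≡σ₂∖[] n = begin
  sum (map (_^ 2) (filter (_∣? n) (map suc (upTo n))))
    ≡⟨ sum-map-filter (_∣? n) (_^ 2) (map suc (upTo n)) ⟩
  sum (map term (map suc (upTo n)))
    ≡⟨ cong sum (map-∘ (upTo n)) ⟨
  sum (map (term ∘ suc) (upTo n))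
    ≡⟨ sum-map-applyUpTo (term ∘ suc) (λ i → i) n ⟩
  Σ< n (term ∘ suc)
    ≡⟨ cong (_+ Σ< n (term ∘ suc)) (indicator-zero (0 ∣? n)) ⟨
  Σ< (suc n) term
    ≡⟨ Σ<-cong (suc n) {f = term} nothing-excluded ⟩
  σ₂∖ n [] ∎
  where
  open ≡-Reasoning
  term : ℕ → ℕ
  term d = indicator (d ∣? n) (d ^ 2)
  nothing-excluded : ∀ d → term d ≡ contribution n [] d
  nothing-excluded d = indicator-cong {P? = d ∣? n} {Q? = counted? n [] d}
                         (_, λ ()) (λ (d∣n , _) → d∣n) (square d)

σ₂∖-peel : ∀ {n S d} .{{_ : NonZero n}} → d ∣ n → d ∉ S → σ₂∖ n S ≡ d * d + σ₂∖ n (d ∷ S)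
σ₂∖-peel {n} {S} {d} d∣n d∉S =
  trans (Σ<-extract (suc n) (s≤s (∣⇒≤ d∣n)) excluded agree)
        (cong (_+ σ₂∖ n (d ∷ S)) (indicator-yes {P? = counted? n S d} (d∣n , d∉S)))
  where
  excluded : contribution n (d ∷ S) d ≡ 0
  excluded = indicator-no {P? = counted? n (d ∷ S) d} (λ (_ , d∉d∷S) → d∉d∷S (here refl))
  agree : ∀ {x} → x ≢ d → contribution n S x ≡ contribution n (d ∷ S) x
  agree {x} x≢d = indicator-cong {P? = counted? n S x} {Q? = counted? n (d ∷ S) x}
                    (λ (x∣n , x∉S) → x∣n , ∉-∷ x≢d x∉S)
                             (λ (x∣n , x∉d∷S) → x∣n , x∉d∷S ∘ there) refl

σ₂∖-≥ : ∀ {n S d} .{{_ : NonZero n}} → d ∣ n → d ∉ S → d * d ≤ σ₂∖ n S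
σ₂∖-≥ {n} {S} {d} d∣n d∉S = subst (d * d ≤_) (sym (σ₂∖-peel d∣n d∉S)) (m≤m+n _ _)

σ₂∖-≥-pair : ∀ {n S d e} .{{_ : NonZero n}} → d ∣ n → e ∣ n → d ∉ S → e ∉ S → e ≢ d →
             d * d + e * e ≤ σ₂∖ n S
σ₂∖-≥-pair {n} {S} {d} {e} d∣n e∣n d∉S e∉S e≢d =
  subst (d * d + e * e ≤_) (sym (σ₂∖-peel d∣n d∉S)) (+-monoʳ-≤ (d * d) (σ₂∖-≥ e∣n (∉-∷ e≢d e∉S)))

σ₂∖-witness : ∀ {n S} → 0 < σ₂∖ n S → ∃[ d ] Counted n S d
σ₂∖-witness {n} {S} pos with Σ<-witness (suc n) (contribution n S) pos
... | d , _ , pos-d = d , indicator-pos {P? = counted? n S d} pos-d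

σ₂∖-vanish : ∀ {n S} → (∀ {d} → d ∣ n → d ∈ S) → σ₂∖ n S ≡ 0
σ₂∖-vanish {n} {S} all∈S with σ₂∖ n S in eq
... | zero  = refl
... | suc _ with σ₂∖-witness (subst (0 <_) (sym eq) z<s)
...   | d , d∣n , d∉S = contradiction (all∈S d∣n) d∉S

σ₂∖≡0⇒∈ : ∀ {n S d} .{{_ : NonZero n}} → σ₂∖ n S ≡ 0 → d ∣ n → d ∈ S
σ₂∖≡0⇒∈ {n} {S} {d} vanishes d∣n with d ∈? S
... | yes d∈S = d∈S
... | no d∉S  = contradiction (0∣⇒≡0 (subst (_∣ n) d≡0 d∣n)) (≢-nonZero⁻¹ n)
  where
  d≡0 : d ≡ 0
  d≡0 = m^n≡0⇒m≡0 d 2 (trans (square d) (n≤0⇒n≡0 (subst (d * d ≤_) vanishes (σ₂∖-≥ d∣n d∉S))))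

σ₂-minus-square : ∀ n .{{_ : NonZero n}} → σ₂ n ∸ n ^ 2 ≡ σ₂∖ n (n ∷ [])
σ₂-minus-square n = begin
  σ₂ n ∸ n ^ 2                        ≡⟨ cong (_∸ n ^ 2) (σ₂≡σ₂∖[] n) ⟩
  σ₂∖ n [] ∸ n ^ 2                    ≡⟨ cong₂ _∸_ (σ₂∖-peel ∣-refl (λ ())) (square n) ⟩
  n * n + σ₂∖ n (n ∷ []) ∸ n * n      ≡⟨ m+n∸m≡n (n * n) _ ⟩
  σ₂∖ n (n ∷ []) ∎
  where open ≡-Reasoning

CofactorClosed : ℕ → List ℕ → Set
CofactorClosed n S = ∀ {x y} → x * y ≡ n → x ∈ S → y ∈ S

factor-∣ˡ : ∀ {d e n} → d * e ≡ n → d ∣ n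
factor-∣ˡ {d} {e} de≡n = divides e (sym (trans (*-comm e d) de≡n))

factor-∣ʳ : ∀ d {e n} → d * e ≡ n → e ∣ n
factor-∣ʳ d de≡n = divides d (sym de≡n)

remaining-cofactors : ∀ {n S} → CofactorClosed n S → 0 < σ₂∖ n S →
                      ∃[ d ] ∃[ e ] (d * e ≡ n × d ∉ S × e ∉ S)
remaining-cofactors {n} closed pos with σ₂∖-witness pos
... | d , divides e n≡e*d , d∉S =
  d , e , trans (*-comm d e) (sym n≡e*d) , d∉S , λ e∈S → d∉S (closed (sym n≡e*d) e∈S)

2xy≤x²+y²-ordered : ∀ {x y} → x ≤ y → 2 * (x * y) ≤ x * x + y * y
2xy≤x²+y²-ordered {x} x≤y with m≤n⇒∃[o]m+o≡n x≤y
... | t , refl = subst (2 * (x * (x + t)) ≤_) (sym (square-gap x t)) (m≤m+n _ _)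
  where
  square-gap : ∀ x t → x * x + (x + t) * (x + t) ≡ 2 * (x * (x + t)) + t * t
  square-gap = solve-∀

2xy≤x²+y² : ∀ x y → 2 * (x * y) ≤ x * x + y * y
2xy≤x²+y² x y with ≤-total x y
... | inj₁ x≤y = 2xy≤x²+y²-ordered x≤y
... | inj₂ y≤x = subst₂ _≤_ (cong (2 *_) (*-comm y x)) (+-comm (y * y) (x * x)) (2xy≤x²+y²-ordered y≤x)

-- Under cofactor closure the remaining divisors contribute nothing or at least n:
-- the larger of a remaining pair d * e = n has square at least n.
σ₂∖-zero-or-≥ : ∀ {n S} .{{_ : NonZero n}} → CofactorClosed n S → σ₂∖ n S ≡ 0 ⊎ n ≤ σ₂∖ n S
σ₂∖-zero-or-≥ {n} {S} closed with σ₂∖ n S ≟ 0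
... | yes vanishes = inj₁ vanishes
... | no nonzero with remaining-cofactors closed (n≢0⇒n>0 nonzero)
...   | d , e , de≡n , d∉S , e∉S with ≤-total d e
...     | inj₁ d≤e = inj₂ (begin
          n       ≡⟨ de≡n ⟨
          d * e   ≤⟨ *-monoˡ-≤ e d≤e ⟩
          e * e   ≤⟨ σ₂∖-≥ (factor-∣ʳ d de≡n) e∉S ⟩
          σ₂∖ n S ∎)
  where open ≤-Reasoning
...     | inj₂ e≤d = inj₂ (begin
          n       ≡⟨ de≡n ⟨
          d * e   ≤⟨ *-monoʳ-≤ d e≤d ⟩
          d * d   ≤⟨ σ₂∖-≥ (factor-∣ˡ de≡n) d∉S ⟩
          σ₂∖ n S ∎)
  where open ≤-Reasoning

-- If moreover every square root of n is excluded, a remaining pair consists of two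
-- distinct divisors, so by the AM–GM inequality they contribute at least 2n.
σ₂∖-zero-or-≥2n : ∀ {n S} .{{_ : NonZero n}} → CofactorClosed n S → (∀ {x} → x * x ≡ n → x ∈ S) →
                  σ₂∖ n S ≡ 0 ⊎ 2 * n ≤ σ₂∖ n S
σ₂∖-zero-or-≥2n {n} {S} closed roots∈S with σ₂∖ n S ≟ 0
... | yes vanishes = inj₁ vanishes
... | no nonzero with remaining-cofactors closed (n≢0⇒n>0 nonzero)
...   | d , e , de≡n , d∉S , e∉S = inj₂ (begin
          2 * n            ≡⟨ cong (2 *_) de≡n ⟨
          2 * (d * e)      ≤⟨ 2xy≤x²+y² d e ⟩
          d * d + e * e    ≤⟨ σ₂∖-≥-pair (factor-∣ˡ de≡n) (factor-∣ʳ d de≡n) d∉S e∉S e≢d ⟩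
          σ₂∖ n S ∎)
  where
  open ≤-Reasoning
  e≢d : e ≢ d
  e≢d refl = d∉S (roots∈S de≡n)

cofactor-of-1 : ∀ {y n} → 1 * y ≡ n → y ≡ n
cofactor-of-1 {y} 1y≡n = trans (sym (*-identityˡ y)) 1y≡n

cofactor-of-self : ∀ {y n} .{{_ : NonZero n}} → n * y ≡ n → y ≡ 1
cofactor-of-self {y} {n} ny≡n = *-cancelˡ-≡ y 1 n (trans ny≡n (sym (*-identityʳ n)))

trivial-closed : ∀ {n} .{{_ : NonZero n}} → CofactorClosed n (1 ∷ n ∷ [])
trivial-closed xy≡n (here refl)         = there (here (cofactor-of-1 xy≡n))
trivial-closed xy≡n (there (here refl)) = here (cofactor-of-self xy≡n)

σ₂∖-peel-1 : ∀ {n} → 2 ≤ n → σ₂∖ n (n ∷ []) ≡ 1 + σ₂∖ n (1 ∷ n ∷ [])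
σ₂∖-peel-1 {n} 2≤n = σ₂∖-peel {{>-nonZero (<-trans z<s 2≤n)}} (1∣ n) 1∉[n]
  where
  1∉[n] : 1 ∉ n ∷ []
  1∉[n] (here 1≡n) = <-irrefl 1≡n 2≤n

module Factorisation {a b n : ℕ} (ab≡n : a * b ≡ n) (2≤a : 2 ≤ a) (2≤b : 2 ≤ b) where

  instance
    a≢0 : NonZero a
    a≢0 = >-nonZero (<-trans z<s 2≤a)
    b≢0 : NonZero b
    b≢0 = >-nonZero (<-trans z<s 2≤b)
    n≢0 : NonZero n
    n≢0 = subst NonZero ab≡n (m*n≢0 a b)

  a<n : a < n
  a<n = subst (a <_) ab≡n (m<m*n a b 2≤b)

  b<n : b < n
  b<n = subst (b <_) (trans (*-comm b a) ab≡n) (m<m*n b a 2≤a)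

  a≢1 : a ≢ 1
  a≢1 a≡1 = <-irrefl (sym a≡1) 2≤a

  a∉[1,n] : a ∉ 1 ∷ n ∷ []
  a∉[1,n] = ∉-∷ a≢1 (∉-∷ (<⇒≢ a<n) λ ())

  σ₂∖-peel-1-a : σ₂∖ n (n ∷ []) ≡ 1 + (a * a + σ₂∖ n (a ∷ 1 ∷ n ∷ []))
  σ₂∖-peel-1-a = trans (σ₂∖-peel-1 (<-trans 2≤a a<n)) (cong (1 +_) (σ₂∖-peel (factor-∣ˡ ab≡n) a∉[1,n]))

  σ₂∖-peel-1-a-b : a < b → σ₂∖ n (n ∷ []) ≡ 1 + (a * a + (b * b + σ₂∖ n (b ∷ a ∷ 1 ∷ n ∷ [])))
  σ₂∖-peel-1-a-b a<b =
    trans σ₂∖-peel-1-a (cong (λ r → 1 + (a * a + r)) (σ₂∖-peel (factor-∣ʳ a ab≡n) b∉[a,1,n]))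
    where
    b∉[a,1,n] : b ∉ a ∷ 1 ∷ n ∷ []
    b∉[a,1,n] = ∉-∷ (≢-sym (<⇒≢ a<b)) (∉-∷ (λ b≡1 → <-irrefl (sym b≡1) 2≤b) (∉-∷ (<⇒≢ b<n) λ ()))

  square-closed : a ≡ b → CofactorClosed n (a ∷ 1 ∷ n ∷ [])
  square-closed a≡b {y = y} ay≡n (here refl) =
    here (*-cancelˡ-≡ y a a (trans ay≡n (trans (sym ab≡n) (cong (a *_) (sym a≡b)))))
  square-closed a≡b xy≡n (there x∈[1,n]) = there (trivial-closed xy≡n x∈[1,n])

  rectangle-closed : CofactorClosed n (b ∷ a ∷ 1 ∷ n ∷ [])
  rectangle-closed {y = y} by≡n (here refl) =
    there (here (*-cancelˡ-≡ y a b (trans by≡n (trans (sym ab≡n) (*-comm a b)))))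
  rectangle-closed {y = y} ay≡n (there (here refl)) =
    here (*-cancelˡ-≡ y b a (trans ay≡n (sym ab≡n)))
  rectangle-closed xy≡n (there (there x∈[1,n])) = there (there (trivial-closed xy≡n x∈[1,n]))

semiprime-divisors : ∀ {p q d} → Prime p → Prime q → d ∣ p * q → d ∈ q ∷ p ∷ 1 ∷ p * q ∷ []
semiprime-divisors {p} {q} {d} p-prime q-prime (divides e pq≡ed)
  with euclidsLemma e d p-prime (divides q (trans (sym pq≡ed) (*-comm p q)))
... | inj₂ (divides c refl) with prime⇒irreducible q-prime (divides e q≡ec)
  where
  instance
    p≢0 : NonZero p
    p≢0 = prime⇒nonZero p-prime
  q≡ec : q ≡ e * c
  q≡ec = *-cancelˡ-≡ q (e * c) p (trans pq≡ed (rearrange e c p))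
    where
    rearrange : ∀ e c p → e * (c * p) ≡ p * (e * c)
    rearrange = solve-∀
...   | inj₁ refl = there (here (*-identityˡ p))
...   | inj₂ refl = there (there (there (here (*-comm q p))))
semiprime-divisors {p} {q} {d} p-prime q-prime (divides e pq≡ed)
  | inj₁ (divides c refl) with prime⇒irreducible q-prime (divides c q≡cd)
  where
  instance
    p≢0 : NonZero p
    p≢0 = prime⇒nonZero p-prime
  q≡cd : q ≡ c * d
  q≡cd = *-cancelˡ-≡ q (c * d) p (trans pq≡ed (rearrange c p d))
    where
    rearrange : ∀ c p d → c * p * d ≡ p * (c * d)
    rearrange = solve-∀
...   | inj₁ refl = there (there (here refl))
...   | inj₂ refl = here refl

prime≥2 : ∀ {p} → Prime p → 2 ≤ p
prime≥2 {p} p-prime = nonTrivial⇒n>1 p {{prime⇒nonTrivial p-prime}}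

σ₂∖-semiprime : ∀ {p q} → Prime p → Prime q → p < q →
                σ₂∖ (p * q) (p * q ∷ []) ≡ 1 + (p * p + q * q)
σ₂∖-semiprime {p} {q} p-prime q-prime p<q = begin
  σ₂∖ (p * q) (p * q ∷ [])             ≡⟨ σ₂∖-peel-1-a-b p<q ⟩
  1 + (p * p + (q * q + rest))         ≡⟨ cong (λ r → 1 + (p * p + (q * q + r))) rest≡0 ⟩
  1 + (p * p + (q * q + 0))            ≡⟨ cong (λ r → 1 + (p * p + r)) (+-identityʳ (q * q)) ⟩
  1 + (p * p + q * q)                  ∎
  where
  open ≡-Reasoning
  open Factorisation {p} {q} refl (prime≥2 p-prime) (prime≥2 q-prime)
  rest : ℕ
  rest = σ₂∖ (p * q) (q ∷ p ∷ 1 ∷ p * q ∷ [])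
  rest≡0 : rest ≡ 0
  rest≡0 = σ₂∖-vanish (semiprime-divisors p-prime q-prime)

prime-pair⇒solution : ∀ {p k} → 0 < k → Prime p → Prime (p + k) →
                      σ₂ (p * (p + k)) ∸ (p * (p + k)) ^ 2 ≡ 2 * (p * (p + k)) + (k ^ 2 + 1)
prime-pair⇒solution {p} {k} 0<k p-prime q-prime = begin
  σ₂ n ∸ n ^ 2                                 ≡⟨ σ₂-minus-square n ⟩
  σ₂∖ n (n ∷ [])                               ≡⟨ σ₂∖-semiprime p-prime q-prime p<p+k ⟩
  1 + (p * p + (p + k) * (p + k))              ≡⟨ pair-identity p k ⟩
  2 * n + (k * k + 1)                          ≡⟨ cong (λ s → 2 * n + (s + 1)) (square k) ⟨
  2 * n + (k ^ 2 + 1)                          ∎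
  where
  open ≡-Reasoning
  n : ℕ
  n = p * (p + k)
  instance
    n≢0 : NonZero n
    n≢0 = m*n≢0 p (p + k) {{prime⇒nonZero p-prime}} {{prime⇒nonZero q-prime}}
  p<p+k : p < p + k
  p<p+k = subst (_≤ p + k) (+-comm p 1) (+-monoʳ-≤ p 0<k)
  pair-identity : ∀ p k → 1 + (p * p + (p + k) * (p + k)) ≡ 2 * (p * (p + k)) + (k * k + 1)
  pair-identity = solve-∀

square-injective : ∀ {x y} → x * x ≡ y * y → x ≡ y
square-injective {x} {y} xx≡yy with <-cmp x y
... | tri< x<y _ _ = contradiction xx≡yy (<⇒≢ (*-mono-< x<y x<y))
... | tri≈ _ x≡y _ = x≡y
... | tri> _ _ y<x = contradiction xx≡yy (>⇒≢ (*-mono-< y<x y<x))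

σ₂∖-prime : ∀ {n} → Prime n → σ₂∖ n (n ∷ []) ≡ 1
σ₂∖-prime {n} n-prime = trans (σ₂∖-peel-1 (prime≥2 n-prime)) (cong (1 +_) (σ₂∖-vanish trivial))
  where
  trivial : ∀ {d} → d ∣ n → d ∈ 1 ∷ n ∷ []
  trivial d∣n with prime⇒irreducible n-prime d∣n
  ... | inj₁ refl = here refl
  ... | inj₂ refl = there (here refl)

composite⇒factorisation : ∀ {n} → Composite n → ∃[ a ] ∃[ b ] (a * b ≡ n × 2 ≤ a × a ≤ b)
composite⇒factorisation (composite {d} d<n (divides zero refl)) = contradiction d<n λ ()
composite⇒factorisation (composite {d} d<n (divides 1 refl))    =
  contradiction (subst (d <_) (+-identityʳ d) d<n) (n≮n d)
composite⇒factorisation (composite {d} d<n (divides e@(suc (suc _)) refl)) with ≤-total d e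
... | inj₁ d≤e = d , e , *-comm d e , nonTrivial⇒n>1 d , d≤e
... | inj₂ e≤d = e , d , refl , s≤s (s≤s z≤n) , e≤d

-- When k² < n, a square n = a * a is never a solution: the equation forces the
-- divisors other than 1, a, n to contribute n + k² < 2n, yet they are either
-- absent or contribute at least 2n.
square-not-solution : ∀ {a n k} → a * a ≡ n → 2 ≤ a → k * k < n →
                      σ₂∖ n (n ∷ []) ≢ 2 * n + (k * k + 1)
square-not-solution {a} {n} {k} aa≡n 2≤a kk<n solution =
  [ rest≢0 , (<⇒≱ rest<2n) ]′ (σ₂∖-zero-or-≥2n (square-closed refl) root∈S)
  where
  open Factorisation aa≡n 2≤a 2≤a
  open ≡-Reasoning
  rest : ℕ
  rest = σ₂∖ n (a ∷ 1 ∷ n ∷ [])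
  root∈S : ∀ {x} → x * x ≡ n → x ∈ a ∷ 1 ∷ n ∷ []
  root∈S xx≡n = here (square-injective (trans xx≡n (sym aa≡n)))
  rearrange : ∀ n K → 2 * n + (K + 1) ≡ 1 + (n + (n + K))
  rearrange = solve-∀
  rest≡n+k² : rest ≡ n + k * k
  rest≡n+k² = +-cancelˡ-≡ n _ _ (suc-injective (begin
    1 + (n + rest)          ≡⟨ cong (λ x → 1 + (x + rest)) aa≡n ⟨
    1 + (a * a + rest)      ≡⟨ σ₂∖-peel-1-a ⟨
    σ₂∖ n (n ∷ [])          ≡⟨ solution ⟩
    2 * n + (k * k + 1)     ≡⟨ rearrange n (k * k) ⟩
    1 + (n + (n + k * k))   ∎))
  rest≢0 : rest ≢ 0
  rest≢0 rest≡0 = ≢-nonZero⁻¹ n (m+n≡0⇒m≡0 n (trans (sym rest≡n+k²) rest≡0))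
  rest<2n : rest < 2 * n
  rest<2n = subst₂ _<_ (sym rest≡n+k²) (cong (n +_) (sym (+-identityʳ n))) (+-monoʳ-< n kk<n)

-- When k² < n, a solution n = a * b with 2 ≤ a < b has b = a + k and no
-- divisors besides 1, a, b, n: writing b = a + t, the equation says that the
-- remaining divisors contribute k² − t² < n, hence nothing.
rectangle-solution : ∀ {a b n k} → a * b ≡ n → 2 ≤ a → a < b → k * k < n →
                     σ₂∖ n (n ∷ []) ≡ 2 * n + (k * k + 1) →
                     b ≡ a + k × σ₂∖ n (b ∷ a ∷ 1 ∷ n ∷ []) ≡ 0
rectangle-solution {a} {b} {n} {k} ab≡n 2≤a a<b kk<n solution with m≤n⇒∃[o]m+o≡n (<⇒≤ a<b)
... | t , refl = cong (a +_) t≡k , rest≡0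
  where
  open Factorisation ab≡n 2≤a (<-trans 2≤a a<b)
  open ≡-Reasoning
  rest : ℕ
  rest = σ₂∖ n (a + t ∷ a ∷ 1 ∷ n ∷ [])
  rearrange : ∀ a t r → 1 + (a * a + ((a + t) * (a + t) + r)) ≡ 2 * (a * (a + t)) + (1 + (t * t + r))
  rearrange = solve-∀
  excess : t * t + rest ≡ k * k
  excess = suc-injective (+-cancelˡ-≡ (2 * n) _ _ (begin
    2 * n + (1 + (t * t + rest))               ≡⟨ cong (λ x → 2 * x + (1 + (t * t + rest))) ab≡n ⟨
    2 * (a * (a + t)) + (1 + (t * t + rest))   ≡⟨ rearrange a t rest ⟨
    1 + (a * a + ((a + t) * (a + t) + rest))   ≡⟨ σ₂∖-peel-1-a-b a<b ⟨
    σ₂∖ n (n ∷ [])                             ≡⟨ solution ⟩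
    2 * n + (k * k + 1)                        ≡⟨ cong (2 * n +_) (+-comm (k * k) 1) ⟩
    2 * n + (1 + k * k)                        ∎))
  rest<n : rest < n
  rest<n = ≤-<-trans (subst (rest ≤_) excess (m≤n+m rest (t * t))) kk<n
  rest≡0 : rest ≡ 0
  rest≡0 = [ (λ rest≡0 → rest≡0) , (λ n≤rest → contradiction n≤rest (<⇒≱ rest<n)) ]′
           (σ₂∖-zero-or-≥ rectangle-closed)
  t≡k : t ≡ k
  t≡k = square-injective (begin
    t * t          ≡⟨ +-identityʳ (t * t) ⟨
    t * t + 0      ≡⟨ cong (t * t +_) rest≡0 ⟨
    t * t + rest   ≡⟨ excess ⟩
    k * k          ∎)

prime-factors : ∀ {a b n} → a * b ≡ n → 2 ≤ a → a < b → σ₂∖ n (b ∷ a ∷ 1 ∷ n ∷ []) ≡ 0 →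
                Prime a × (Prime b ⊎ b ≡ a * a)
prime-factors {a} {b} {n} ab≡n 2≤a a<b rest≡0 = a-prime , b-prime-or-square
  where
  open Factorisation ab≡n 2≤a (<-trans 2≤a a<b)
  known : ∀ {d} → d ∣ n → d ∈ b ∷ a ∷ 1 ∷ n ∷ []
  known = σ₂∖≡0⇒∈ rest≡0

  a-prime : Prime a
  a-prime = irreducible⇒prime {{n>1⇒nonTrivial 2≤a}} irreducible
    where
    irreducible : ∀ {d} → d ∣ a → d ≡ 1 ⊎ d ≡ a
    irreducible d∣a with known (∣-trans d∣a (factor-∣ˡ ab≡n))
    ... | here refl                           = contradiction (∣⇒≤ d∣a) (<⇒≱ a<b)
    ... | there (here refl)                   = inj₂ refl
    ... | there (there (here refl))           = inj₁ refl
    ... | there (there (there (here refl)))   = contradiction (∣⇒≤ d∣a) (<⇒≱ a<n)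

  -- if a ∣ b then the cofactor b / a also divides n, and only b / a = a is possible
  b-square : a ∣ b → b ≡ a * a
  b-square (divides c b≡ca) = cofactor-is-a (divides a (trans b≡ca (*-comm c a)))
    where
    cofactor-is-a : c ∣ b → b ≡ a * a
    cofactor-is-a c∣b with known (∣-trans c∣b (factor-∣ʳ a ab≡n))
    ... | here refl                         = contradiction (cofactor-of-self (sym b≡ca)) a≢1
    ... | there (here refl)                 = b≡ca
    ... | there (there (here refl))         = contradiction (trans b≡ca (+-identityʳ a)) (>⇒≢ a<b)
    ... | there (there (there (here refl))) = contradiction (∣⇒≤ c∣b) (<⇒≱ b<n)

  b-prime-or-square : Prime b ⊎ b ≡ a * a
  b-prime-or-square with a ∣? b
  ... | yes a∣b = inj₂ (b-square a∣b)
  ... | no a∤b = inj₁ (irreducible⇒prime {{n>1⇒nonTrivial (<-trans 2≤a a<b)}} irreducible)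
    where
    irreducible : ∀ {d} → d ∣ b → d ≡ 1 ⊎ d ≡ b
    irreducible d∣b with known (∣-trans d∣b (factor-∣ʳ a ab≡n))
    ... | here refl                           = inj₂ refl
    ... | there (here refl)                   = contradiction d∣b a∤b
    ... | there (there (here refl))           = inj₁ refl
    ... | there (there (there (here refl)))   = contradiction (∣⇒≤ d∣b) (<⇒≱ b<n)

≤-cube : ∀ {c x y} → x ≤ c → y ≤ c * c → x * y ≤ c ^ 3
≤-cube {c} {x} {y} x≤c y≤cc = subst (x * y ≤_) (cong (c *_) (sym (square c))) (*-mono-≤ x≤c y≤cc)

≤-square : ∀ {c y} → 1 ≤ c → y ≤ c → y ≤ c * c
≤-square {c} 1≤c y≤c = ≤-trans y≤c (m≤m*n c c {{>-nonZero 1≤c}})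

-- If a² = a + k with a ≥ 2, then a ≤ k (otherwise a + k < 2a ≤ a²).
root≤ : ∀ {a k} → 2 ≤ a → a * a ≡ a + k → a ≤ k
root≤ {a} {k} 2≤a aa≡a+k with a ≤? k
... | yes a≤k = a≤k
... | no a≰k  = contradiction aa≡a+k (>⇒≢ (begin-strict
  a + k     <⟨ +-monoʳ-< a (≰⇒> a≰k) ⟩
  a + a     ≡⟨ cong (a +_) (+-identityʳ a) ⟨
  2 * a     ≤⟨ *-monoˡ-≤ a 2≤a ⟩
  a * a     ∎))
  where open ≤-Reasoning

-- A solution n = a (a + k) beyond (N + k)³ has its smaller factor a ≥ N, and
-- a + k ≠ a² (that would make n = a³ ≤ k³).
large-factor : ∀ {a k N} → 2 ≤ a → (N + k) ^ 3 < a * (a + k) → N ≤ a × a + k ≢ a * a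
large-factor {a} {k} {N} 2≤a bound = N≤a , a+k≢aa
  where
  N≤a : N ≤ a
  N≤a with N ≤? a
  ... | yes N≤a = N≤a
  ... | no N≰a  = contradiction (≤-cube a≤c (≤-square (≤-trans (<-trans z<s 2≤a) a≤c) a+k≤c)) (<⇒≱ bound)
    where
    a≤c : a ≤ N + k
    a≤c = ≤-trans (<⇒≤ (≰⇒> N≰a)) (m≤m+n N k)
    a+k≤c : a + k ≤ N + k
    a+k≤c = +-monoˡ-≤ k (<⇒≤ (≰⇒> N≰a))
  a+k≢aa : a + k ≢ a * a
  a+k≢aa a+k≡aa = contradiction (≤-cube a≤c (subst (_≤ (N + k) * (N + k)) (sym a+k≡aa) (*-mono-≤ a≤c a≤c)))
                                (<⇒≱ bound)
    where
    a≤c : a ≤ N + k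
    a≤c = ≤-trans (root≤ 2≤a (sym a+k≡aa)) (m≤n+m k N)

solution⇒prime-pair : ∀ {k N n} → 0 < k → (N + k) ^ 3 < n → σ₂ n ∸ n ^ 2 ≡ 2 * n + (k ^ 2 + 1) →
                      ∃[ p ] (N ≤ p × Prime p × Prime (p + k))
solution⇒prime-pair {k} {N} {n} 0<k bound solution′ =
  from-factorisation (composite⇒factorisation n-composite)
  where
  c : ℕ
  c = N + k
  instance
    c≢0 : NonZero c
    c≢0 = >-nonZero (≤-trans 0<k (m≤n+m k N))
  2≤n : 2 ≤ n
  2≤n = ≤-<-trans (m^n>0 c 3) bound
  instance
    n≢0 : NonZero n
    n≢0 = >-nonZero (<-trans z<s 2≤n)
  solution : σ₂∖ n (n ∷ []) ≡ 2 * n + (k * k + 1)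
  solution = trans (sym (σ₂-minus-square n)) (trans solution′ (cong (λ s → 2 * n + (s + 1)) (square k)))
  k²<n : k * k < n
  k²<n = ≤-<-trans (≤-cube (m≤n+m k N) (≤-square (>-nonZero⁻¹ c) (m≤n+m k N))) bound
  -- n is not prime, since for a prime the sum over proper divisors is 1
  n-composite : Composite n
  n-composite = ¬prime⇒composite {{n>1⇒nonTrivial 2≤n}} λ n-prime →
    <⇒≢ (<-≤-trans 2≤n (≤-trans (m≤m+n n (n + 0)) (m≤m+n (2 * n) (k * k + 1))))
        (trans (sym (σ₂∖-prime n-prime)) solution)
  -- a = b is impossible; for a < b we get b = a + k with a, b prime (b = a² is too small)
  from-factorisation : ∃[ a ] ∃[ b ] (a * b ≡ n × 2 ≤ a × a ≤ b) → ∃[ p ] (N ≤ p × Prime p × Prime (p + k))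
  from-factorisation (a , b , ab≡n , 2≤a , a≤b) with m≤n⇒m<n∨m≡n a≤b
  ... | inj₂ refl = contradiction solution (square-not-solution {k = k} ab≡n 2≤a k²<n)
  ... | inj₁ a<b with rectangle-solution {k = k} ab≡n 2≤a a<b k²<n solution
  ...   | refl , rest≡0 with prime-factors ab≡n 2≤a a<b rest≡0
                            | large-factor 2≤a (subst (c ^ 3 <_) (sym ab≡n) bound)
  ...     | a-prime , inj₁ b-prime | N≤a , _    = a , N≤a , a-prime , b-prime
  ...     | _       , inj₂ b≡aa    | _   , b≢aa = contradiction b≡aa b≢aa

corollary1p7 : (k : ℕ) → 0 < k → 2 ∣ k →
    (Infinite (λ p → Prime p × Prime (p + k))
      ⇔ Infinite (λ n → 0 < n × σ₂ n ∸ n ^ 2 ≡ 2 * n + (k ^ 2 + 1)))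
corollary1p7 k 0<k _ = mk⇔ pairs⇒solutions solutions⇒pairs
  where
  -- each prime pair (p, p + k) with p ≥ N gives the solution p (p + k) ≥ N
  pairs⇒solutions : Infinite (λ p → Prime p × Prime (p + k)) →
                    Infinite (λ n → 0 < n × σ₂ n ∸ n ^ 2 ≡ 2 * n + (k ^ 2 + 1))
  pairs⇒solutions pairs N with pairs N
  ... | p , N≤p , p-prime , q-prime =
    p * (p + k) , ≤-trans N≤p (m≤m*n p (p + k)) , >-nonZero⁻¹ (p * (p + k)) ,
    prime-pair⇒solution 0<k p-prime q-prime
    where
    instance
      p≢0 : NonZero p
      p≢0 = prime⇒nonZero p-prime
      q≢0 : NonZero (p + k)
      q≢0 = prime⇒nonZero q-prime
      n≢0 : NonZero (p * (p + k))
      n≢0 = m*n≢0 p (p + k)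

  -- each solution n > (N + k)³ gives a prime pair (p, p + k) with p ≥ N
  solutions⇒pairs : Infinite (λ n → 0 < n × σ₂ n ∸ n ^ 2 ≡ 2 * n + (k ^ 2 + 1)) →
                    Infinite (λ p → Prime p × Prime (p + k))
  solutions⇒pairs solutions N with solutions (suc ((N + k) ^ 3))
  ... | n , bound , _ , solution = solution⇒prime-pair 0<k bound solution
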